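{- Let $p$ be an odd prime and let $\alpha,\beta,\gamma$ be positive integers with $0<\gamma<\alpha\leq\beta+\gamma$. Let $$G_{\alpha,\beta,\gamma}=\langle a,b\mid a^{p^\alpha}=1,\ b^{p^\beta}=1,\ b^{ -1}ab=a^{1+p^\gamma}\rangle.$$ Then: (1) for any $i\in\mathbb{Z}_{p^\alpha}$, $j\in\mathbb{Z}_{p^\beta}$ and positive integer $k$, $$(b^{j}a^{i})^{k}=b^{kj}a^{\,i[(1+p^\gamma)^{(k-1)j}+(1+p^\gamma)^{(k-2)j}+\cdots+(1+p^\gamma)^{j}+1]};$$ (2) if there is an automorphism $\theta$ of $G_{\alpha,\beta,\gamma}$ such that $a^{\theta}=b^ma^n$ with $\gcd(m,p)=1$, then $\beta<\alpha$. -}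

module Defs where

open import Data.Nat using (ℕ; zero; suc; _+_; _*_; _^_)
open import Data.Bool using (Bool; true; false; not)
open import Data.Product using (_×_; _,_; ∃)
open import Data.List using (List; []; _∷_; _++_; replicate; concat; reverse; map)

data Gen : Set where
  ga gb : Gen

-- A letter is a generator together with a flag: false = x, true = x⁻¹.
Letter : Set
Letter = Gen × Bool

Word : Set
Word = List Letter

gpow : Gen → ℕ → Word
gpow x n = replicate n (x , false)

ginv : Gen → Word
ginv x = (x , true) ∷ []

wpow : Word → ℕ → Word
wpow w k = concat (replicate k w)

data GEq (p α β γ : ℕ) : Word → Word → Set where
  ≈refl  : ∀ {u} → GEq p α β γ u u
  ≈sym   : ∀ {u v} → GEq p α β γ u v → GEq p α β γ v u
  ≈trans : ∀ {u v w} → GEq p α β γ u v → GEq p α β γ v w → GEq p α β γ u w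
  ≈cong  : ∀ {u u' v v'} → GEq p α β γ u u' → GEq p α β γ v v' →
           GEq p α β γ (u ++ v) (u' ++ v')
  ≈free  : ∀ x s → GEq p α β γ ((x , s) ∷ (x , not s) ∷ []) []
  ≈relA  : GEq p α β γ (gpow ga (p ^ α)) []
  ≈relB  : GEq p α β γ (gpow gb (p ^ β)) []
  ≈relC  : GEq p α β γ (ginv gb ++ gpow ga 1 ++ gpow gb 1) (gpow ga (1 + p ^ γ))

record IsAutomorphism (p α β γ : ℕ) (θ : Word → Word) : Set where
  field
    wellDefined : ∀ {u v} → GEq p α β γ u v → GEq p α β γ (θ u) (θ v)
    homomorphic : ∀ u v → GEq p α β γ (θ (u ++ v)) (θ u ++ θ v)
    injective   : ∀ u v → GEq p α β γ (θ u) (θ v) → GEq p α β γ u v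
    surjective  : ∀ v → ∃ λ u → GEq p α β γ (θ u) v

geomSum : ℕ → ℕ → ℕ → ℕ
geomSum r j zero = 0
geomSum r j (suc k) = r ^ (k * j) + geomSum r j k

-- The formula (1) is the usual collection argument: moving a power a^i past b^j
-- multiplies its exponent by (1 + p^γ)^j, by the third relation.
--
-- For (2), sending a word to the exponent sum of b in it is a homomorphism
-- G → ℤ/p^β, since every relator has b-exponent 0 mod p^β; composing it with θ
-- gives another homomorphism f. Conjugation is invisible in ℤ/p^β, so the
-- relation b⁻¹ab = a^{1+p^γ} forces p^γ f(a) ≡ 0. As θ(a) = b^m a^n, f(a) ≡ m
-- mod p^β, hence p^β ∣ p^γ m; with p ∤ m this gives β ≤ γ < α.
module Submission where

open import Defs
open import Data.Bool using (true; false)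
open import Data.Integer as ℤ using (ℤ; +_; -_; _-_)
import Data.Integer.Properties as ℤ
open import Data.Integer.Divisibility.Signed as ℤ∣
  using (∣m∣n⇒∣m+n; ∣m⇒∣-m; ∣n⇒∣m*n; ∣⇒∣ᵤ)
open import Data.Integer.Tactic.RingSolver using (solve-∀)
open import Data.List using ([]; _∷_; _++_)
import Data.List.Properties as List
open import Data.Nat using (ℕ; zero; suc; _+_; _*_; _^_; _∸_; _<_; _≤_; _≤?_; _%_)
import Data.Nat.Properties as ℕ
open import Data.Nat.Coprimality using (gcd≡1⇒coprime)
open import Data.Nat.Divisibility using (_∣_; divides; ∣-refl; ∣-trans; *-cancelˡ-∣)
open import Data.Nat.GCD using (gcd)
open import Data.Nat.Primality using (Prime; ¬prime[1]; prime⇒nonZero)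
open import Data.Product using (_×_; _,_)
open import Function using (_∘_)
open import Relation.Binary.Bundles using (Setoid)
open import Relation.Binary.PropositionalEquality
  using (_≡_; refl; sym; trans; cong; cong₂; subst; module ≡-Reasoning)
import Relation.Binary.Reasoning.Setoid as SetoidReasoning
open import Relation.Nullary using (yes; no; contradiction)

infix 4 _≡_[mod_]

record _≡_[mod_] (x y : ℤ) (n : ℕ) : Set where
  constructor ≡-mod
  field divides-difference : + n ℤ∣.∣ x - y

module _ {n : ℕ} where

  ≡-mod-by : ∀ x y {z} → z ≡ x - y → + n ℤ∣.∣ z → x ≡ y [mod n ]
  ≡-mod-by _ _ eq = ≡-mod ∘ subst (+ n ℤ∣.∣_) eq

  ≡-mod-refl : ∀ {x} → x ≡ x [mod n ]
  ≡-mod-refl {x} = ≡-mod-by x x (sym (ℤ.+-inverseʳ x)) (ℤ∣.divides (+ 0) refl)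

  ≡⇒≡-mod : ∀ {x y} → x ≡ y → x ≡ y [mod n ]
  ≡⇒≡-mod refl = ≡-mod-refl

  ≡-mod-sym : ∀ {x y} → x ≡ y [mod n ] → y ≡ x [mod n ]
  ≡-mod-sym {x} {y} (≡-mod d) = ≡-mod-by y x (negate x y) (∣m⇒∣-m d)
    where
    negate : ∀ x y → - (x - y) ≡ y - x
    negate = solve-∀

  ≡-mod-trans : ∀ {x y z} → x ≡ y [mod n ] → y ≡ z [mod n ] → x ≡ z [mod n ]
  ≡-mod-trans {x} {y} {z} (≡-mod d) (≡-mod e) =
    ≡-mod-by x z (ℤ.+-minus-telescope x y z) (∣m∣n⇒∣m+n d e)

  +-cong-mod : ∀ {x x' y y'} → x ≡ x' [mod n ] → y ≡ y' [mod n ] →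
               x ℤ.+ y ≡ x' ℤ.+ y' [mod n ]
  +-cong-mod {x} {x'} {y} {y'} (≡-mod d) (≡-mod e) =
    ≡-mod-by _ _ (regroup x x' y y') (∣m∣n⇒∣m+n d e)
    where
    regroup : ∀ x x' y y' → (x - x') ℤ.+ (y - y') ≡ (x ℤ.+ y) - (x' ℤ.+ y')
    regroup = solve-∀

  +-congˡ-mod : ∀ x {y y'} → y ≡ y' [mod n ] → x ℤ.+ y ≡ x ℤ.+ y' [mod n ]
  +-congˡ-mod x = +-cong-mod (≡-mod-refl {x})

  *-congˡ-mod : ∀ c {x y} → x ≡ y [mod n ] → c ℤ.* x ≡ c ℤ.* y [mod n ]
  *-congˡ-mod c {x} {y} (≡-mod d) = ≡-mod-by _ _ (distrib c x y) (∣n⇒∣m*n c d)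
    where
    distrib : ∀ c x y → c ℤ.* (x - y) ≡ c ℤ.* x - c ℤ.* y
    distrib = solve-∀

  +-cancelˡ-mod : ∀ x {y z} → x ℤ.+ y ≡ x ℤ.+ z [mod n ] → y ≡ z [mod n ]
  +-cancelˡ-mod x {y} {z} (≡-mod d) = ≡-mod-by y z (cancel x y z) d
    where
    cancel : ∀ x y z → (x ℤ.+ y) - (x ℤ.+ z) ≡ y - z
    cancel = solve-∀

  n≡0[mod-n] : + n ≡ + 0 [mod n ]
  n≡0[mod-n] = ≡-mod (ℤ∣.divides (+ 1) (trans (ℤ.+-identityʳ (+ n)) (sym (ℤ.*-identityˡ (+ n)))))

≡0-mod⇒∣ : ∀ {n x} → x ≡ + 0 [mod n ] → n ∣ ℤ.∣ x ∣
≡0-mod⇒∣ {n} {x} (≡-mod d) = ∣⇒∣ᵤ (subst (+ n ℤ∣.∣_) (ℤ.+-identityʳ x) d)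

≡-mod-setoid : ℕ → Setoid _ _
≡-mod-setoid n = record
  { Carrier = ℤ
  ; _≈_ = _≡_[mod n ]
  ; isEquivalence = record
    { refl = ≡-mod-refl ; sym = ≡-mod-sym ; trans = ≡-mod-trans }
  }

gpow-+ : ∀ x m n → gpow x (m + n) ≡ gpow x m ++ gpow x n
gpow-+ x zero n = refl
gpow-+ x (suc m) n = cong (_ ∷_) (gpow-+ x m n)

b-exponent : Word → ℤ
b-exponent [] = + 0
b-exponent ((ga , _) ∷ w) = b-exponent w
b-exponent ((gb , false) ∷ w) = ℤ.1ℤ ℤ.+ b-exponent w
b-exponent ((gb , true) ∷ w) = ℤ.-1ℤ ℤ.+ b-exponent w

b-exponent-++ : ∀ u v → b-exponent (u ++ v) ≡ b-exponent u ℤ.+ b-exponent v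
b-exponent-++ [] v = sym (ℤ.+-identityˡ (b-exponent v))
b-exponent-++ ((ga , _) ∷ u) v = b-exponent-++ u v
b-exponent-++ ((gb , false) ∷ u) v =
  trans (cong (ℤ._+_ ℤ.1ℤ) (b-exponent-++ u v)) (sym (ℤ.+-assoc ℤ.1ℤ (b-exponent u) (b-exponent v)))
b-exponent-++ ((gb , true) ∷ u) v =
  trans (cong (ℤ._+_ ℤ.-1ℤ) (b-exponent-++ u v)) (sym (ℤ.+-assoc ℤ.-1ℤ (b-exponent u) (b-exponent v)))

b-exponent-aⁿ : ∀ n → b-exponent (gpow ga n) ≡ + 0
b-exponent-aⁿ zero = refl
b-exponent-aⁿ (suc n) = b-exponent-aⁿ n

b-exponent-bⁿ : ∀ n → b-exponent (gpow gb n) ≡ + n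
b-exponent-bⁿ zero = refl
b-exponent-bⁿ (suc n) = cong (ℤ._+_ ℤ.1ℤ) (b-exponent-bⁿ n)

module Presentation (p α β γ : ℕ) where

  infix 4 _≈_

  _≈_ : Word → Word → Set
  _≈_ = GEq p α β γ

  ≈-setoid : Setoid _ _
  ≈-setoid = record
    { Carrier = Word
    ; _≈_ = _≈_
    ; isEquivalence = record { refl = ≈refl ; sym = ≈sym ; trans = ≈trans }
    }

  ≡⇒≈ : ∀ {u v} → u ≡ v → u ≈ v
  ≡⇒≈ refl = ≈refl

  ++-congˡ : ∀ u {v v'} → v ≈ v' → u ++ v ≈ u ++ v'
  ++-congˡ u = ≈cong ≈refl

  ++-congʳ : ∀ {u u'} v → u ≈ u' → u ++ v ≈ u' ++ v
  ++-congʳ v e = ≈cong e ≈refl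

  ++-assoc : ∀ u v w → (u ++ v) ++ w ≈ u ++ (v ++ w)
  ++-assoc u v w = ≡⇒≈ (List.++-assoc u v w)

  a b : Word
  a = gpow ga 1
  b = gpow gb 1

  r : ℕ
  r = 1 + p ^ γ

  ab≈ba^r : a ++ b ≈ b ++ gpow ga r
  ab≈ba^r = begin
    a ++ b                    ≈⟨ ++-congʳ (a ++ b) (≈free gb false) ⟨
    b ++ (ginv gb ++ a ++ b)  ≈⟨ ++-congˡ b ≈relC ⟩
    b ++ gpow ga r            ∎
    where open SetoidReasoning ≈-setoid

  aⁱb≈ba^ir : ∀ i → gpow ga i ++ b ≈ b ++ gpow ga (i * r)
  aⁱb≈ba^ir zero = ≈refl
  aⁱb≈ba^ir (suc i) = begin
    a ++ gpow ga i ++ b                  ≈⟨ ++-congˡ a (aⁱb≈ba^ir i) ⟩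
    a ++ b ++ gpow ga (i * r)            ≈⟨ ++-assoc a b (gpow ga (i * r)) ⟨
    (a ++ b) ++ gpow ga (i * r)          ≈⟨ ++-congʳ _ ab≈ba^r ⟩
    (b ++ gpow ga r) ++ gpow ga (i * r)  ≈⟨ ++-assoc b (gpow ga r) (gpow ga (i * r)) ⟩
    b ++ gpow ga r ++ gpow ga (i * r)    ≡⟨ cong (b ++_) (gpow-+ ga r (i * r)) ⟨
    b ++ gpow ga (suc i * r)             ∎
    where open SetoidReasoning ≈-setoid

  aⁱbʲ≈bʲa^ir^j : ∀ i j → gpow ga i ++ gpow gb j ≈ gpow gb j ++ gpow ga (i * r ^ j)
  aⁱbʲ≈bʲa^ir^j i zero = ≡⇒≈ (begin
    gpow ga i ++ []       ≡⟨ List.++-identityʳ _ ⟩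
    gpow ga i             ≡⟨ cong (gpow ga) (ℕ.*-identityʳ i) ⟨
    gpow ga (i * 1)       ∎)
    where open ≡-Reasoning
  aⁱbʲ≈bʲa^ir^j i (suc j) = begin
    gpow ga i ++ b ++ gpow gb j                ≈⟨ ++-assoc (gpow ga i) b _ ⟨
    (gpow ga i ++ b) ++ gpow gb j              ≈⟨ ++-congʳ _ (aⁱb≈ba^ir i) ⟩
    (b ++ gpow ga (i * r)) ++ gpow gb j        ≈⟨ ++-assoc b (gpow ga (i * r)) (gpow gb j) ⟩
    b ++ gpow ga (i * r) ++ gpow gb j          ≈⟨ ++-congˡ b (aⁱbʲ≈bʲa^ir^j (i * r) j) ⟩
    b ++ gpow gb j ++ gpow ga (i * r * r ^ j)  ≡⟨ cong (λ e → b ++ gpow gb j ++ gpow ga e) (ℕ.*-assoc i r (r ^ j)) ⟩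
    b ++ gpow gb j ++ gpow ga (i * r ^ suc j)  ∎
    where open SetoidReasoning ≈-setoid

  [bʲaⁱ]ᵏ≈b^kj·a^i·geomSum : ∀ i j k →
    wpow (gpow gb j ++ gpow ga i) k ≈ gpow gb (k * j) ++ gpow ga (i * geomSum r j k)
  [bʲaⁱ]ᵏ≈b^kj·a^i·geomSum i j zero = ≡⇒≈ (cong (gpow ga) (sym (ℕ.*-zeroʳ i)))
  [bʲaⁱ]ᵏ≈b^kj·a^i·geomSum i j (suc k) = begin
    (bʲ ++ aⁱ) ++ wpow (bʲ ++ aⁱ) k        ≈⟨ ++-congˡ (bʲ ++ aⁱ) ([bʲaⁱ]ᵏ≈b^kj·a^i·geomSum i j k) ⟩
    (bʲ ++ aⁱ) ++ gpow gb (k * j) ++ a^iS  ≈⟨ ++-assoc bʲ aⁱ _ ⟩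
    bʲ ++ aⁱ ++ gpow gb (k * j) ++ a^iS    ≈⟨ ++-congˡ bʲ (++-assoc aⁱ _ _) ⟨
    bʲ ++ (aⁱ ++ gpow gb (k * j)) ++ a^iS  ≈⟨ ++-congˡ bʲ (++-congʳ a^iS (aⁱbʲ≈bʲa^ir^j i (k * j))) ⟩
    bʲ ++ (gpow gb (k * j) ++ gpow ga (i * r ^ (k * j))) ++ a^iS
      ≈⟨ ++-congˡ bʲ (++-assoc (gpow gb (k * j)) _ _) ⟩
    bʲ ++ gpow gb (k * j) ++ gpow ga (i * r ^ (k * j)) ++ a^iS
      ≈⟨ ++-assoc bʲ _ _ ⟨
    (bʲ ++ gpow gb (k * j)) ++ gpow ga (i * r ^ (k * j)) ++ a^iS
      ≡⟨ cong₂ _++_ (gpow-+ gb j (k * j)) (gpow-+ ga (i * r ^ (k * j)) (i * S)) ⟨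
    gpow gb (j + k * j) ++ gpow ga (i * r ^ (k * j) + i * S)
      ≡⟨ cong (λ e → gpow gb (j + k * j) ++ gpow ga e) (ℕ.*-distribˡ-+ i (r ^ (k * j)) S) ⟨
    gpow gb (suc k * j) ++ gpow ga (i * geomSum r j (suc k)) ∎
    where
    open SetoidReasoning ≈-setoid
    bʲ = gpow gb j
    aⁱ = gpow ga i
    S = geomSum r j k
    a^iS = gpow ga (i * S)

  record IsHomℤmod (n : ℕ) (f : Word → ℤ) : Set where
    field
      respects : ∀ {u v} → u ≈ v → f u ≡ f v [mod n ]
      additive : ∀ u v → f (u ++ v) ≡ f u ℤ.+ f v [mod n ]

    open SetoidReasoning (≡-mod-setoid n)

    f[]≡0 : f [] ≡ + 0 [mod n ]
    f[]≡0 = +-cancelˡ-mod (f []) (begin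
      f [] ℤ.+ f []  ≈⟨ additive [] [] ⟨
      f []           ≡⟨ ℤ.+-identityʳ (f []) ⟨
      f [] ℤ.+ + 0   ∎)

    f-gpow : ∀ x k → f (gpow x k) ≡ + k ℤ.* f (gpow x 1) [mod n ]
    f-gpow x zero = f[]≡0
    f-gpow x (suc k) = begin
      f (gpow x 1 ++ gpow x k)              ≈⟨ additive (gpow x 1) (gpow x k) ⟩
      f (gpow x 1) ℤ.+ f (gpow x k)         ≈⟨ +-congˡ-mod (f (gpow x 1)) (f-gpow x k) ⟩
      f (gpow x 1) ℤ.+ + k ℤ.* f (gpow x 1) ≡⟨ ℤ.suc-* (+ k) (f (gpow x 1)) ⟨
      + suc k ℤ.* f (gpow x 1)              ∎

    f-conj : ∀ x w → f (ginv x ++ w ++ gpow x 1) ≡ f w [mod n ]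
    f-conj x w = begin
      f (x⁻¹ ++ w ++ x¹)              ≈⟨ additive x⁻¹ (w ++ x¹) ⟩
      f x⁻¹ ℤ.+ f (w ++ x¹)           ≈⟨ +-congˡ-mod (f x⁻¹) (additive w x¹) ⟩
      f x⁻¹ ℤ.+ (f w ℤ.+ f x¹)        ≡⟨ swap (f x⁻¹) (f w) (f x¹) ⟩
      f w ℤ.+ (f x⁻¹ ℤ.+ f x¹)        ≈⟨ +-congˡ-mod (f w) (additive x⁻¹ x¹) ⟨
      f w ℤ.+ f (x⁻¹ ++ x¹)           ≈⟨ +-congˡ-mod (f w) (respects (≈free x true)) ⟩
      f w ℤ.+ f []                    ≈⟨ +-congˡ-mod (f w) f[]≡0 ⟩
      f w ℤ.+ + 0                     ≡⟨ ℤ.+-identityʳ (f w) ⟩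
      f w                             ∎
      where
      x⁻¹ x¹ : Word
      x⁻¹ = ginv x
      x¹ = gpow x 1
      swap : ∀ u v w → u ℤ.+ (v ℤ.+ w) ≡ v ℤ.+ (u ℤ.+ w)
      swap = solve-∀

    p^γ*f[a]≡0 : + (p ^ γ) ℤ.* f a ≡ + 0 [mod n ]
    p^γ*f[a]≡0 = +-cancelˡ-mod (f a) (begin
      f a ℤ.+ + (p ^ γ) ℤ.* f a  ≡⟨ ℤ.suc-* (+ (p ^ γ)) (f a) ⟨
      + r ℤ.* f a                ≈⟨ f-gpow ga r ⟨
      f (gpow ga r)              ≈⟨ respects ≈relC ⟨
      f (ginv gb ++ a ++ b)      ≈⟨ f-conj gb a ⟩
      f a                        ≡⟨ ℤ.+-identityʳ (f a) ⟨
      f a ℤ.+ + 0                ∎)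

  IsHomℤmod-∘ : ∀ {n f θ} → (∀ {u v} → u ≈ v → θ u ≈ θ v) →
                (∀ u v → θ (u ++ v) ≈ θ u ++ θ v) →
                IsHomℤmod n f → IsHomℤmod n (f ∘ θ)
  IsHomℤmod-∘ {θ = θ} θ-wd θ-hom f-hom = record
    { respects = respects ∘ θ-wd
    ; additive = λ u v → ≡-mod-trans (respects (θ-hom u v)) (additive (θ u) (θ v))
    }
    where open IsHomℤmod f-hom

  b-exponent-respects : ∀ {u v} → u ≈ v → b-exponent u ≡ b-exponent v [mod p ^ β ]
  b-exponent-respects ≈refl = ≡-mod-refl
  b-exponent-respects (≈sym e) = ≡-mod-sym (b-exponent-respects e)
  b-exponent-respects (≈trans e f) = ≡-mod-trans (b-exponent-respects e) (b-exponent-respects f)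
  b-exponent-respects (≈cong {u} {u'} {v} {v'} e f) = begin
    b-exponent (u ++ v)                ≡⟨ b-exponent-++ u v ⟩
    b-exponent u ℤ.+ b-exponent v      ≈⟨ +-cong-mod (b-exponent-respects e) (b-exponent-respects f) ⟩
    b-exponent u' ℤ.+ b-exponent v'    ≡⟨ b-exponent-++ u' v' ⟨
    b-exponent (u' ++ v')              ∎
    where open SetoidReasoning (≡-mod-setoid (p ^ β))
  b-exponent-respects (≈free ga s) = ≡-mod-refl
  b-exponent-respects (≈free gb false) = ≡-mod-refl
  b-exponent-respects (≈free gb true) = ≡-mod-refl
  b-exponent-respects ≈relA = ≡⇒≡-mod (b-exponent-aⁿ (p ^ α))
  b-exponent-respects ≈relB = ≡-mod-trans (≡⇒≡-mod (b-exponent-bⁿ (p ^ β))) n≡0[mod-n]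
  b-exponent-respects ≈relC = ≡⇒≡-mod (sym (b-exponent-aⁿ r))

  b-exponent-isHomℤmod : IsHomℤmod (p ^ β) b-exponent
  b-exponent-isHomℤmod = record
    { respects = b-exponent-respects
    ; additive = λ u v → ≡⇒≡-mod (b-exponent-++ u v)
    }

  θ[a]≈bᵐaⁿ⇒p^β∣p^γ*m : ∀ {θ} → IsAutomorphism p α β γ θ → ∀ m n →
                         θ a ≈ gpow gb m ++ gpow ga n → p ^ β ∣ p ^ γ * m
  θ[a]≈bᵐaⁿ⇒p^β∣p^γ*m {θ} θ-aut m n θ[a]≈bᵐaⁿ =
    subst (p ^ β ∣_) (ℤ.abs-* (+ (p ^ γ)) (+ m)) (≡0-mod⇒∣ p^γ*m≡0)
    where
    open IsAutomorphism θ-aut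
    f-hom : IsHomℤmod (p ^ β) (b-exponent ∘ θ)
    f-hom = IsHomℤmod-∘ wellDefined homomorphic b-exponent-isHomℤmod
    open IsHomℤmod f-hom using (p^γ*f[a]≡0)

    f[a]≡m : b-exponent (θ a) ≡ + m [mod p ^ β ]
    f[a]≡m = ≡-mod-trans (b-exponent-respects θ[a]≈bᵐaⁿ) (≡⇒≡-mod (begin
      b-exponent (gpow gb m ++ gpow ga n)               ≡⟨ b-exponent-++ (gpow gb m) (gpow ga n) ⟩
      b-exponent (gpow gb m) ℤ.+ b-exponent (gpow ga n) ≡⟨ cong₂ ℤ._+_ (b-exponent-bⁿ m) (b-exponent-aⁿ n) ⟩
      + m ℤ.+ + 0                                       ≡⟨ ℤ.+-identityʳ (+ m) ⟩
      + m                                               ∎))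
      where open ≡-Reasoning

    p^γ*m≡0 : + (p ^ γ) ℤ.* + m ≡ + 0 [mod p ^ β ]
    p^γ*m≡0 = ≡-mod-trans (*-congˡ-mod (+ (p ^ γ)) (≡-mod-sym f[a]≡m)) p^γ*f[a]≡0

^-monoʳ-∣ : ∀ p {m n} → m ≤ n → p ^ m ∣ p ^ n
^-monoʳ-∣ p {m} {n} m≤n = divides (p ^ (n ∸ m)) (begin
  p ^ n                   ≡⟨ cong (p ^_) (ℕ.m+[n∸m]≡n m≤n) ⟨
  p ^ (m + (n ∸ m))       ≡⟨ ℕ.^-distribˡ-+-* p m (n ∸ m) ⟩
  p ^ m * p ^ (n ∸ m)     ≡⟨ ℕ.*-comm (p ^ m) (p ^ (n ∸ m)) ⟩
  p ^ (n ∸ m) * p ^ m     ∎)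
  where open ≡-Reasoning

p^β∣p^γ*m⇒β≤γ : ∀ {p β γ m} → Prime p → gcd m p ≡ 1 → p ^ β ∣ p ^ γ * m → β ≤ γ
p^β∣p^γ*m⇒β≤γ {p} {β} {γ} {m} p-prime gcd[m,p]≡1 p^β∣p^γm with β ≤? γ
... | yes β≤γ = β≤γ
... | no β≰γ = contradiction (subst Prime p≡1 p-prime) ¬prime[1]
  where
  instance
    _ = prime⇒nonZero p-prime
    _ = ℕ.m^n≢0 p γ
  p^γ*p∣p^γ*m : p ^ γ * p ∣ p ^ γ * m
  p^γ*p∣p^γ*m = subst (_∣ p ^ γ * m) (ℕ.*-comm p (p ^ γ))
                  (∣-trans (^-monoʳ-∣ p (ℕ.≰⇒> β≰γ)) p^β∣p^γm)
  p≡1 : p ≡ 1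
  p≡1 = gcd≡1⇒coprime gcd[m,p]≡1 (*-cancelˡ-∣ (p ^ γ) p^γ*p∣p^γ*m , ∣-refl)

mainTheorem2 : (p α β γ : ℕ) → Prime p → p % 2 ≡ 1 →
    0 < α → 0 < β → 0 < γ → γ < α → α ≤ β + γ →
    ((i j k : ℕ) → i < p ^ α → j < p ^ β → 0 < k →
      GEq p α β γ (wpow (gpow gb j ++ gpow ga i) k)
        (gpow gb (k * j) ++ gpow ga (i * geomSum (1 + p ^ γ) j k)))
    × ((θ : Word → Word) → IsAutomorphism p α β γ θ → (m n : ℕ) →
      GEq p α β γ (θ (gpow ga 1)) (gpow gb m ++ gpow ga n) → gcd m p ≡ 1 →
      β < α)
mainTheorem2 p α β γ p-prime _ _ _ _ γ<α _ =
  (λ i j k _ _ _ → [bʲaⁱ]ᵏ≈b^kj·a^i·geomSum i j k) ,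
  λ θ θ-aut m n θ[a]≈bᵐaⁿ gcd[m,p]≡1 →
    ℕ.≤-<-trans (p^β∣p^γ*m⇒β≤γ p-prime gcd[m,p]≡1 (θ[a]≈bᵐaⁿ⇒p^β∣p^γ*m θ-aut m n θ[a]≈bᵐaⁿ)) γ<α
  where open Presentation p α β γ
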